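{- Let $N = 2m$ with $m \in \mathbb{N}$, $m \ge 3$, and let $L^1_{opt}(N) = \frac{N^2}{4} + \frac{N}{2}$. (a) For every network $G$ on $N$ nodes with fewer than $L^1_{opt}(N)$ links, there exists a set of $N/2$ nodes whose removal (together with incident links) results in a network that is not connected. (b) There exists a network $G$ on $N$ nodes with exactly $L^1_{opt}(N)$ links which is $N/2$-robust.
   Context: A network is a finite simple undirected graph; links are edges. For an integer $N_f$, a network $G$ is $N_f$-robust if for every set $S$ of $N_f$ nodes of $G$, the network obtained by deleting the nodes of $S$ and their incident links is connected. -}

module Defs where

open import Data.Nat using (ℕ; zero; suc; _+_; _<_)
open import Data.Bool using (Bool; true; false; if_then_else_)
open import Data.Fin using (Fin; toℕ)
open import Data.Fin.Subset using (Subset; _∉_; ∣_∣)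
open import Data.Product using (_×_)
open import Relation.Binary.PropositionalEquality using (_≡_)
open import Relation.Nullary.Decidable using (⌊_⌋)
open import Relation.Binary.Construct.Closure.ReflexiveTransitive using (Star)
import Data.Nat as ℕ
open import Data.Bool using (_∧_)

record Network (n : ℕ) : Set where
  field
    adj   : Fin n → Fin n → Bool
    sym   : ∀ i j → adj i j ≡ adj j i
    irrefl : ∀ i → adj i i ≡ false
open Network public

count : ∀ {n} → (Fin n → Bool) → ℕ
count {zero}  f = 0
count {suc n} f = (if f Fin.zero then 1 else 0) + count (λ i → f (Fin.suc i))
  where import Data.Fin as Fin

sumFin : ∀ {n} → (Fin n → ℕ) → ℕ
sumFin {zero}  f = 0
sumFin {suc n} f = f Fin.zero + sumFin (λ i → f (Fin.suc i))
  where import Data.Fin as Fin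

links : ∀ {n} → Network n → ℕ
links G = sumFin (λ i → count (λ j → ⌊ toℕ i ℕ.<? toℕ j ⌋ ∧ adj G i j))

StepOutside : ∀ {n} → Network n → Subset n → Fin n → Fin n → Set
StepOutside G S u w = u ∉ S × w ∉ S × adj G u w ≡ true

ConnectedAfterRemoving : ∀ {n} → Network n → Subset n → Set
ConnectedAfterRemoving G S =
  ∀ u v → u ∉ S → v ∉ S → Star (StepOutside G S) u v

Robust : ∀ {n} → ℕ → Network n → Set
Robust k G = ∀ (S : Subset _) → ∣ S ∣ ≡ k → ConnectedAfterRemoving G S

{-# OPTIONS --safe #-}
-- (a) By the handshake lemma the degrees add up to 2 · links < 2m(m + 1), so some node v has
-- degree d ≤ m. Deleting the d neighbours of v together with m − d further nodes other than v
-- isolates v, while 2m − m ≥ 2 nodes survive, so v is not the only survivor.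
-- (b) Take two m-cliques {0} × ℤ_m and {1} × ℤ_m and join (0 , i) to (1 , j) whenever i = j or
-- i = j − 1. Every node has degree m + 1, so there are m² + m links. After deleting m nodes the
-- survivors on each side still form a clique, and if both sides survive, the survivor sets
-- L, R ⊆ ℤ_m satisfy |L| + |R| = m. Either they meet, giving a rung (0 , i)(1 , i), or they
-- partition ℤ_m; then L is not closed under j − 1 ↦ j, so some j ∈ R has j − 1 ∈ L.
module Submission where

open import Defs hiding (sym)
open import Data.Bool using (Bool; true; false; if_then_else_; not; _∧_; _∨_)
open import Data.Bool.Properties
  using (not-injective; ¬-not; not-¬; ∨-zeroʳ; ∧-zeroʳ; ∧-identityʳ) renaming (_≟_ to _≟ᵇ_)
open import Data.Empty using (⊥; ⊥-elim)
open import Data.Fin using (Fin; zero; suc; toℕ; fromℕ; inject₁; _↑ˡ_; _↑ʳ_; combine; remQuot)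
open import Data.Fin.Induction using (<-weakInduction; <-weakInduction-startingFrom)
open import Data.Fin.Properties
  using (_≟_; any?; ≤fromℕ; toℕ-inject₁; toℕ-injective; remQuot-combine; combine-remQuot)
open import Data.Fin.Subset using (Subset; ∣_∣; _∈_; _∉_)
open import Data.Nat using (ℕ; zero; suc; _+_; _*_; _∸_; _<_; _≤_; z≤n; s≤s; s≤s⁻¹; _<?_; ⌊_/2⌋)
open import Data.Nat.Properties hiding (_≟_)
open import Data.Nat.Tactic.RingSolver using (solve-∀)
open import Data.Product using (_×_; _,_; ∃; ∃₂; ∃-syntax; proj₁; proj₂)
open import Data.Sum using (_⊎_; inj₁; inj₂)
open import Data.Vec using (lookup; tabulate; []; _∷_)
open import Data.Vec.Functional using () renaming (_∷_ to _◂_)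
open import Data.Vec.Properties using ([]=⇒lookup; lookup⇒[]=; lookup∘tabulate)
open import Function using (_∘_)
open import Function.Bundles using (mk⇔)
open import Level using (Level)
open import Relation.Binary.Construct.Closure.ReflexiveTransitive using (Star; ε; _◅_; _◅◅_; reverse)
open import Relation.Binary.Definitions using (tri<; tri≈; tri>)
open import Relation.Binary.PropositionalEquality
open import Relation.Nullary using (¬_; yes; no; does; _×-dec_)
open import Relation.Nullary.Decidable using (⌊_⌋; isYes≗does; dec-true; dec-false; does-⇔; _⊎-dec_)
open import Relation.Unary using (Pred)

private
  variable
    a b k n : ℕ
    ℓ : Level

-- Finite sums and counting

∧-true : {x y : Bool} → x ∧ y ≡ true → x ≡ true × y ≡ true
∧-true {true} {true} _ = refl , refl

indicator : Bool → ℕ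
indicator b = if b then 1 else 0

sumFin-cong : {f g : Fin n → ℕ} → (∀ i → f i ≡ g i) → sumFin f ≡ sumFin g
sumFin-cong {zero}  f≗g = refl
sumFin-cong {suc n} f≗g = cong₂ _+_ (f≗g zero) (sumFin-cong (f≗g ∘ suc))

sumFin-+ : (f g : Fin n → ℕ) → sumFin (λ i → f i + g i) ≡ sumFin f + sumFin g
sumFin-+ {zero}  f g = refl
sumFin-+ {suc n} f g = begin
  (f zero + g zero) + sumFin (λ i → f (suc i) + g (suc i))
    ≡⟨ cong (f zero + g zero +_) (sumFin-+ (f ∘ suc) (g ∘ suc)) ⟩
  (f zero + g zero) + (sumFin (f ∘ suc) + sumFin (g ∘ suc))
    ≡⟨ +-+-interchange (f zero) (g zero) _ _ ⟩
  (f zero + sumFin (f ∘ suc)) + (g zero + sumFin (g ∘ suc))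
    ∎
  where
  open ≡-Reasoning
  +-+-interchange : ∀ w x y z → (w + x) + (y + z) ≡ (w + y) + (x + z)
  +-+-interchange = solve-∀

sumFin-const : ∀ n k → sumFin {n} (λ _ → k) ≡ n * k
sumFin-const zero    k = refl
sumFin-const (suc n) k = cong (k +_) (sumFin-const n k)

sumFin-swap : (f : Fin a → Fin b → ℕ) →
              sumFin (λ i → sumFin (f i)) ≡ sumFin (λ j → sumFin (λ i → f i j))
sumFin-swap {zero}  {b} f = sym (trans (sumFin-const b 0) (*-zeroʳ b))
sumFin-swap {suc a} f = begin
  sumFin (f zero) + sumFin (λ i → sumFin (f (suc i)))
    ≡⟨ cong (sumFin (f zero) +_) (sumFin-swap (f ∘ suc)) ⟩
  sumFin (f zero) + sumFin (λ j → sumFin (λ i → f (suc i) j))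
    ≡⟨ sumFin-+ (f zero) _ ⟨
  sumFin (λ j → sumFin (λ i → f i j))
    ∎
  where open ≡-Reasoning

sumFin-↑ : (f : Fin (a + b) → ℕ) →
           sumFin f ≡ sumFin (λ i → f (i ↑ˡ b)) + sumFin (λ j → f (a ↑ʳ j))
sumFin-↑ {zero}  f = refl
sumFin-↑ {suc a} {b} f = trans (cong (f zero +_) (sumFin-↑ {a} {b} (f ∘ suc))) (sym (+-assoc (f zero) _ _))

sumFin-combine : (f : Fin (a * b) → ℕ) →
                 sumFin f ≡ sumFin {a} (λ s → sumFin {b} (λ i → f (combine s i)))
sumFin-combine {zero}  f = refl
sumFin-combine {suc a} {b} f =
  trans (sumFin-↑ {b} f) (cong (sumFin (λ i → f (i ↑ˡ a * b)) +_) (sumFin-combine {a} (λ x → f (b ↑ʳ x))))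

sumFin<*⇒∃< : (f : Fin n → ℕ) → sumFin f < n * k → ∃ λ i → f i < k
sumFin<*⇒∃< {suc n} {k} f sum< with f zero <? k
... | yes f₀<k = zero , f₀<k
... | no  f₀≮k =
  let (i , fᵢ<k) = sumFin<*⇒∃< (f ∘ suc) (+-cancelˡ-< k _ _ (≤-<-trans (+-monoˡ-≤ _ (≮⇒≥ f₀≮k)) sum<))
  in suc i , fᵢ<k

count≡sumFin : (f : Fin n → Bool) → count f ≡ sumFin (indicator ∘ f)
count≡sumFin {zero}  f = refl
count≡sumFin {suc n} f = cong (indicator (f zero) +_) (count≡sumFin (f ∘ suc))

count-cong : {f g : Fin n → Bool} → (∀ i → f i ≡ g i) → count f ≡ count g
count-cong {zero}  f≗g = refl
count-cong {suc n} f≗g = cong₂ _+_ (cong indicator (f≗g zero)) (count-cong (f≗g ∘ suc))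

count-combine : (f : Fin (a * b) → Bool) →
                count f ≡ sumFin {a} (λ s → count {b} (λ i → f (combine s i)))
count-combine {a} {b} f = begin
  count f
    ≡⟨ count≡sumFin f ⟩
  sumFin (indicator ∘ f)
    ≡⟨ sumFin-combine {a} (indicator ∘ f) ⟩
  sumFin {a} (λ s → sumFin {b} (λ i → indicator (f (combine s i))))
    ≡⟨ sumFin-cong {a} (λ s → count≡sumFin {b} (λ i → f (combine s i))) ⟨
  sumFin {a} (λ s → count {b} (λ i → f (combine s i)))
    ∎
  where open ≡-Reasoning

count-swap : (R : Fin a → Fin b → Bool) →
             sumFin (λ i → count (R i)) ≡ sumFin (λ j → count (λ i → R i j))
count-swap R = begin
  sumFin (λ i → count (R i))                           ≡⟨ sumFin-cong (λ i → count≡sumFin (R i)) ⟩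
  sumFin (λ i → sumFin (λ j → indicator (R i j)))     ≡⟨ sumFin-swap (λ i j → indicator (R i j)) ⟩
  sumFin (λ j → sumFin (λ i → indicator (R i j)))     ≡⟨ sumFin-cong (λ j → count≡sumFin (λ i → R i j)) ⟨
  sumFin (λ j → count (λ i → R i j))                   ∎
  where open ≡-Reasoning

count-+-pointwise : (f g h k : Fin n → Bool) →
  (∀ i → indicator (f i) + indicator (g i) ≡ indicator (h i) + indicator (k i)) →
  count f + count g ≡ count h + count k
count-+-pointwise {n} f g h k eq = begin
  count f + count g                                        ≡⟨ cong₂ _+_ (count≡sumFin f) (count≡sumFin g) ⟩
  sumFin (indicator ∘ f) + sumFin (indicator ∘ g)          ≡⟨ sumFin-+ (indicator ∘ f) (indicator ∘ g) ⟨
  sumFin (λ i → indicator (f i) + indicator (g i))         ≡⟨ sumFin-cong eq ⟩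
  sumFin (λ i → indicator (h i) + indicator (k i))         ≡⟨ sumFin-+ (indicator ∘ h) (indicator ∘ k) ⟩
  sumFin (indicator ∘ h) + sumFin (indicator ∘ k)          ≡⟨ cong₂ _+_ (count≡sumFin h) (count≡sumFin k) ⟨
  count h + count k                                        ∎
  where open ≡-Reasoning

count-∨+count-∧ : (f g : Fin n → Bool) →
                  count (λ i → f i ∨ g i) + count (λ i → f i ∧ g i) ≡ count f + count g
count-∨+count-∧ f g = count-+-pointwise _ _ f g (λ i → indicator-∨-∧ (f i) (g i))
  where
  indicator-∨-∧ : ∀ x y → indicator (x ∨ y) + indicator (x ∧ y) ≡ indicator x + indicator y
  indicator-∨-∧ true  true  = refl
  indicator-∨-∧ true  false = refl
  indicator-∨-∧ false true  = refl
  indicator-∨-∧ false false = refl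

count-false : {f : Fin n → Bool} → (∀ i → f i ≡ false) → count f ≡ 0
count-false {zero}  f≗false = refl
count-false {suc n} f≗false rewrite f≗false zero = count-false (f≗false ∘ suc)

count-not+count : (f : Fin n → Bool) → count (not ∘ f) + count f ≡ n
count-not+count {n} f = begin
  count (not ∘ f) + count f
    ≡⟨ count-+-pointwise _ _ (λ _ → true) (λ _ → false) (λ i → indicator-not (f i)) ⟩
  count {n} (λ _ → true) + count {n} (λ _ → false)
    ≡⟨ cong₂ _+_ (count-true n) (count-false {n} λ _ → refl) ⟩
  n + 0
    ≡⟨ +-identityʳ n ⟩
  n ∎
  where
  open ≡-Reasoning
  indicator-not : ∀ x → indicator (not x) + indicator x ≡ 1 + 0
  indicator-not true  = refl
  indicator-not false = refl
  count-true : ∀ n → count {n} (λ _ → true) ≡ n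
  count-true zero    = refl
  count-true (suc n) = cong suc (count-true n)

count-mono : {f g : Fin n → Bool} → (∀ i → f i ≡ true → g i ≡ true) → count f ≤ count g
count-mono {zero}  f⇒g = z≤n
count-mono {suc n} {f} {g} f⇒g with f zero in f₀ | g zero in g₀
... | false | false = count-mono (f⇒g ∘ suc)
... | false | true  = m≤n⇒m≤1+n (count-mono (f⇒g ∘ suc))
... | true  | true  = s≤s (count-mono (f⇒g ∘ suc))
... | true  | false with () ← trans (sym (f⇒g zero f₀)) g₀

count≡0⇒false : (f : Fin n → Bool) → count f ≡ 0 → ∀ i → f i ≡ false
count≡0⇒false {suc n} f count≡0 i with f zero in f₀
count≡0⇒false {suc n} f count≡0 zero    | false = f₀
count≡0⇒false {suc n} f count≡0 (suc i) | false = count≡0⇒false (f ∘ suc) count≡0 i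

0<count⇒∃ : (f : Fin n → Bool) → 0 < count f → ∃ λ i → f i ≡ true
0<count⇒∃ {suc n} f 0<count with f zero in f₀
... | true  = zero , f₀
... | false = let (i , fᵢ) = 0<count⇒∃ (f ∘ suc) 0<count in suc i , fᵢ

count≡n⇒true : (f : Fin n → Bool) → count f ≡ n → ∀ i → f i ≡ true
count≡n⇒true {n} f count≡n i = not-injective (count≡0⇒false (not ∘ f) count-not≡0 i)
  where
  count-not≡0 : count (not ∘ f) ≡ 0
  count-not≡0 = +-cancelʳ-≡ (count f) _ 0 (trans (count-not+count f) (sym count≡n))

count-≟ : (i : Fin n) → count (λ j → does (j ≟ i)) ≡ 1
count-≟ {suc n} zero    = cong suc (count-false {n} λ _ → refl)
count-≟ {suc n} (suc i) = count-≟ i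

count-≟-∨ : {i i′ : Fin n} → i ≢ i′ → count (λ j → does (j ≟ i) ∨ does (j ≟ i′)) ≡ 2
count-≟-∨ {n} {i} {i′} i≢i′ = +-cancelʳ-≡ 0 _ 2 (begin
  count (λ j → does (j ≟ i) ∨ does (j ≟ i′)) + 0
    ≡⟨ cong (count (λ j → does (j ≟ i) ∨ does (j ≟ i′)) +_) (count-false {n} never-both) ⟨
  count (λ j → does (j ≟ i) ∨ does (j ≟ i′)) + count (λ j → does (j ≟ i) ∧ does (j ≟ i′))
    ≡⟨ count-∨+count-∧ (λ j → does (j ≟ i)) (λ j → does (j ≟ i′)) ⟩
  count (λ j → does (j ≟ i)) + count (λ j → does (j ≟ i′))
    ≡⟨ cong₂ _+_ (count-≟ i) (count-≟ i′) ⟩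
  2 + 0
    ∎)
  where
  open ≡-Reasoning
  never-both : ∀ j → (does (j ≟ i) ∧ does (j ≟ i′)) ≡ false
  never-both j with j ≟ i
  ... | yes refl = dec-false (j ≟ i′) i≢i′
  ... | no _     = refl

does-≟-sym : (i j : Fin n) → does (i ≟ j) ≡ does (j ≟ i)
does-≟-sym i j = does-⇔ (mk⇔ sym sym) (i ≟ j) (j ≟ i)

count-≢ : (i : Fin (suc n)) → count (λ j → not (does (i ≟ j))) ≡ n
count-≢ {n} i = +-cancelʳ-≡ 1 _ n (begin
  count (λ j → not (does (i ≟ j))) + 1
    ≡⟨ cong (count (λ j → not (does (i ≟ j))) +_) (trans (count-cong (does-≟-sym i)) (count-≟ i)) ⟨
  count (λ j → not (does (i ≟ j))) + count (λ j → does (i ≟ j))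
    ≡⟨ count-not+count (λ j → does (i ≟ j)) ⟩
  suc n
    ≡⟨ +-comm 1 n ⟩
  n + 1
    ∎)
  where open ≡-Reasoning

count≤count-others+1 : (f : Fin n → Bool) (v : Fin n) →
                       count f ≤ count (λ w → f w ∧ not (does (w ≟ v))) + 1
count≤count-others+1 {n} f v = begin
  count f
    ≤⟨ count-mono {f = f} {λ w → g w ∨ does (w ≟ v)} f⇒g∨v ⟩
  count (λ w → g w ∨ does (w ≟ v))
    ≤⟨ m≤m+n _ _ ⟩
  count (λ w → g w ∨ does (w ≟ v)) + count (λ w → g w ∧ does (w ≟ v))
    ≡⟨ count-∨+count-∧ g (λ w → does (w ≟ v)) ⟩
  count g + count (λ w → does (w ≟ v))
    ≡⟨ cong (count g +_) (count-≟ v) ⟩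
  count g + 1
    ∎
  where
  open ≤-Reasoning
  g : Fin n → Bool
  g w = f w ∧ not (does (w ≟ v))
  f⇒g∨v : ∀ w → f w ≡ true → (g w ∨ does (w ≟ v)) ≡ true
  f⇒g∨v w fw with w ≟ v
  ... | yes _ = ∨-zeroʳ _
  ... | no  _ rewrite fw = refl

∃-other : (f : Fin n → Bool) (v : Fin n) → 2 ≤ count f → ∃ λ w → w ≢ v × f w ≡ true
∃-other f v 2≤count
  with (w , fw∧w≢v) ← 0<count⇒∃ _ (+-cancelʳ-≤ 1 1 _ (≤-trans 2≤count (count≤count-others+1 f v))) =
  w , (λ w≡v → not-¬ (dec-true (w ≟ v) w≡v) (not-injective (proj₂ (∧-true fw∧w≢v)))) ,
  proj₁ (∧-true fw∧w≢v)

∃-subset-of-size : ∀ r (f : Fin n → Bool) → r ≤ count f →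
                   ∃ λ g → (∀ i → g i ≡ true → f i ≡ true) × count g ≡ r
∃-subset-of-size {n} zero f _ = (λ _ → false) , (λ _ ()) , count-false {n} (λ _ → refl)
∃-subset-of-size {suc n} (suc r) f r<count with f zero in f₀
... | true  = let (g , g⇒f , count-g) = ∃-subset-of-size r (f ∘ suc) (s≤s⁻¹ r<count)
              in (true ◂ g) , (λ { zero _ → f₀ ; (suc i) → g⇒f i }) , cong suc count-g
... | false = let (g , g⇒f , count-g) = ∃-subset-of-size (suc r) (f ∘ suc) r<count
              in (false ◂ g) , (λ { (suc i) → g⇒f i }) , count-g

∣p∣≡count : (p : Subset n) → ∣ p ∣ ≡ count (lookup p)
∣p∣≡count []          = refl
∣p∣≡count (true ∷ p)  = cong suc (∣p∣≡count p)
∣p∣≡count (false ∷ p) = ∣p∣≡count p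

∣tabulate∣≡count : (f : Fin n → Bool) → ∣ tabulate f ∣ ≡ count f
∣tabulate∣≡count f = trans (∣p∣≡count (tabulate f)) (count-cong (lookup∘tabulate f))

∉⇒lookup≡false : (p : Subset n) (x : Fin n) → x ∉ p → lookup p x ≡ false
∉⇒lookup≡false p x x∉p = ¬-not (x∉p ∘ lookup⇒[]= x p)

lookup≡false⇒∉ : (p : Subset n) (x : Fin n) → lookup p x ≡ false → x ∉ p
lookup≡false⇒∉ p x px≡false x∈p with () ← trans (sym ([]=⇒lookup x∈p)) px≡false

-- Degrees and cuts

degree : Network n → Fin n → ℕ
degree G v = count (adj G v)

handshake : (G : Network n) → links G + links G ≡ sumFin (degree G)
handshake {n} G = sym (begin
  sumFin (degree G)
    ≡⟨ sumFin-cong split ⟩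
  sumFin (λ i → count (forward i) + count (backward i))
    ≡⟨ sumFin-+ (count ∘ forward) (count ∘ backward) ⟩
  links G + sumFin (count ∘ backward)
    ≡⟨ cong (links G +_) (count-swap backward) ⟩
  links G + sumFin (λ j → count (λ i → backward i j))
    ≡⟨ cong (links G +_) (sumFin-cong λ j → count-cong λ i → cong (lt j i ∧_) (Network.sym G i j)) ⟩
  links G + links G
    ∎)
  where
  open ≡-Reasoning
  lt : Fin n → Fin n → Bool
  lt i j = ⌊ toℕ i <? toℕ j ⌋
  forward backward : Fin n → Fin n → Bool
  forward  i j = lt i j ∧ adj G i j
  backward i j = lt j i ∧ adj G i j
  lt-true : ∀ {i j} → toℕ i < toℕ j → lt i j ≡ true
  lt-true {i} {j} i<j = trans (isYes≗does (toℕ i <? toℕ j)) (dec-true (toℕ i <? toℕ j) i<j)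
  lt-false : ∀ {i j} → ¬ toℕ i < toℕ j → lt i j ≡ false
  lt-false {i} {j} i≮j = trans (isYes≗does (toℕ i <? toℕ j)) (dec-false (toℕ i <? toℕ j) i≮j)
  indicator-split : ∀ i j → indicator (adj G i j) + indicator false ≡
                            indicator (forward i j) + indicator (backward i j)
  indicator-split i j with <-cmp (toℕ i) (toℕ j)
  ... | tri< i<j _ j≮i rewrite lt-true i<j | lt-false j≮i = refl
  ... | tri> i≮j _ j<i rewrite lt-false i≮j | lt-true j<i = +-comm _ 0
  ... | tri≈ _ i≡j _ rewrite toℕ-injective i≡j | Network.irrefl G j | ∧-zeroʳ (lt j j) = refl
  split : ∀ i → degree G i ≡ count (forward i) + count (backward i)
  split i = begin
    degree G i
      ≡⟨ +-identityʳ _ ⟨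
    degree G i + 0
      ≡⟨ cong (degree G i +_) (count-false {n} λ _ → refl) ⟨
    degree G i + count {n} (λ _ → false)
      ≡⟨ count-+-pointwise (adj G i) _ (forward i) (backward i) (indicator-split i) ⟩
    count (forward i) + count (backward i)
      ∎

isolated-after-removing : (G : Network n) (S : Subset n) {v w : Fin n} →
                          (∀ u → adj G v u ≡ true → u ∈ S) →
                          Star (StepOutside G S) v w → w ≡ v
isolated-after-removing G S N⊆S ε = refl
isolated-after-removing G S N⊆S ((_ , u∉S , vu) ◅ _) = ⊥-elim (u∉S (N⊆S _ vu))

StepOutside-sym : (G : Network n) (S : Subset n) {x y : Fin n} →
                  StepOutside G S x y → StepOutside G S y x
StepOutside-sym G S {x} {y} (x∉S , y∉S , xy) = y∉S , x∉S , trans (Network.sym G y x) xy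

cut-around : (G : Network n) (v : Fin n) (X : Fin n → Bool) →
             X v ≡ false → (∀ u → adj G v u ≡ true → X u ≡ true) → count X ≡ k → suc k < n →
             ∃[ S ] (∣ S ∣ ≡ k × ¬ ConnectedAfterRemoving G S)
cut-around {n} {k} G v X Xv≡false N⊆X count-X k+1<n = S , trans (∣tabulate∣≡count X) count-X , disconnected
  where
  S : Subset n
  S = tabulate X
  ∉S : ∀ {u} → X u ≡ false → u ∉ S
  ∉S {u} Xu = lookup≡false⇒∉ S u (trans (lookup∘tabulate X u) Xu)
  N⊆S : ∀ u → adj G v u ≡ true → u ∈ S
  N⊆S u vu = lookup⇒[]= u S (trans (lookup∘tabulate X u) (N⊆X u vu))
  2≤count-not-X : 2 ≤ count (not ∘ X)
  2≤count-not-X = +-cancelʳ-≤ k 2 _ (begin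
    2 + k                      ≤⟨ k+1<n ⟩
    n                          ≡⟨ count-not+count X ⟨
    count (not ∘ X) + count X  ≡⟨ cong (count (not ∘ X) +_) count-X ⟩
    count (not ∘ X) + k        ∎)
    where open ≤-Reasoning
  disconnected : ¬ ConnectedAfterRemoving G S
  disconnected connected with (w , w≢v , ¬Xw) ← ∃-other (not ∘ X) v 2≤count-not-X =
    w≢v (isolated-after-removing G S N⊆S (connected v w (∉S Xv≡false) (∉S (not-injective ¬Xw))))

low-degree⇒cut : (G : Network n) (v : Fin n) → degree G v ≤ k → suc k < n →
                 ∃[ S ] (∣ S ∣ ≡ k × ¬ ConnectedAfterRemoving G S)
low-degree⇒cut {n} {k} G v d≤k k+1<n = extend (∃-subset-of-size (k ∸ d) E k∸d≤count-E)
  where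
  N : Fin n → Bool
  N = adj G v
  d : ℕ
  d = degree G v
  E : Fin n → Bool
  E u = not (N u) ∧ not (does (u ≟ v))
  k∸d≤count-E : k ∸ d ≤ count E
  k∸d≤count-E = m≤n+o⇒m∸n≤o k d (s≤s⁻¹ (≤-trans (s≤s (n≤1+n k)) (begin
    suc (suc k)         ≤⟨ k+1<n ⟩
    n                   ≡⟨ count-not+count N ⟨
    count (not ∘ N) + d ≤⟨ +-monoˡ-≤ d (count≤count-others+1 (not ∘ N) v) ⟩
    count E + 1 + d     ≡⟨ rearrange (count E) d ⟩
    suc (d + count E)   ∎)))
    where
    open ≤-Reasoning
    rearrange : ∀ x y → x + 1 + y ≡ suc (y + x)
    rearrange = solve-∀
  extend : (∃ λ T → (∀ u → T u ≡ true → E u ≡ true) × count T ≡ k ∸ d) →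
           ∃[ S ] (∣ S ∣ ≡ k × ¬ ConnectedAfterRemoving G S)
  extend (T , T⊆E , count-T) =
    cut-around G v (λ u → N u ∨ T u) (cong₂ _∨_ (Network.irrefl G v) v∉T) (λ u Nu → cong (_∨ T u) Nu)
               count-N∨T k+1<n
    where
    v∉T : T v ≡ false
    v∉T = ¬-not λ Tv → not-¬ (dec-true (v ≟ v) refl) (not-injective (proj₂ (∧-true (T⊆E v Tv))))
    N∧T≡false : ∀ u → (N u ∧ T u) ≡ false
    N∧T≡false u with T u in Tu
    ... | false = ∧-zeroʳ (N u)
    ... | true  = trans (∧-identityʳ (N u)) (not-injective (proj₁ (∧-true (T⊆E u Tu))))
    count-N∨T : count (λ u → N u ∨ T u) ≡ k
    count-N∨T = begin
      count (λ u → N u ∨ T u)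
        ≡⟨ +-identityʳ _ ⟨
      count (λ u → N u ∨ T u) + 0
        ≡⟨ cong (count (λ u → N u ∨ T u) +_) (count-false N∧T≡false) ⟨
      count (λ u → N u ∨ T u) + count (λ u → N u ∧ T u)
        ≡⟨ count-∨+count-∧ N T ⟩
      d + count T
        ≡⟨ cong (d +_) count-T ⟩
      d + (k ∸ d)
        ≡⟨ m+[n∸m]≡n d≤k ⟩
      k ∎
      where open ≡-Reasoning

sparse⇒low-degree : (G : Network n) → links G + links G < n * suc k → ∃ λ v → degree G v ≤ k
sparse⇒low-degree G sparse =
  let (v , deg-v<1+k) = sumFin<*⇒∃< (degree G) (subst (_< _) (handshake G) sparse) in v , s≤s⁻¹ deg-v<1+k

sparse⇒cut : ∀ m → 2 ≤ m → (G : Network (2 * m)) → links G < m * m + m →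
             ∃[ S ] (∣ S ∣ ≡ m × ¬ ConnectedAfterRemoving G S)
sparse⇒cut m 2≤m G sparse =
  let (v , deg-v≤m) = sparse⇒low-degree G (subst (links G + links G <_) (double m) (+-mono-< sparse sparse))
  in low-degree⇒cut G v deg-v≤m m+1<2m
  where
  double : ∀ m → (m * m + m) + (m * m + m) ≡ 2 * m * suc m
  double = solve-∀
  m+1<2m : suc m < 2 * m
  m+1<2m = subst (suc m <_) (cong (m +_) (sym (+-identityʳ m))) (+-monoˡ-≤ m 2≤m)

-- The cycle on Fin (suc n)

cyclicPred : Fin (suc n) → Fin (suc n)
cyclicPred {n} zero = fromℕ n
cyclicPred (suc i)  = inject₁ i

cyclicPred-irrefl : (i : Fin (suc (suc n))) → cyclicPred i ≢ i
cyclicPred-irrefl zero    ()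
cyclicPred-irrefl (suc i) i′≡1+i = 1+n≢n (sym (trans (sym (toℕ-inject₁ i)) (cong toℕ i′≡1+i)))

cyclic-induction : (P : Pred (Fin (suc n)) ℓ) {a : Fin (suc n)} → P a →
                   (∀ j → P (cyclicPred j) → P j) → ∀ j → P j
cyclic-induction P {a} Pa step = <-weakInduction P P-zero (step ∘ suc)
  where
  P-zero : P zero
  P-zero = step zero (<-weakInduction-startingFrom P Pa (step ∘ suc) (≤fromℕ a))

bridge : (L R : Fin (suc n) → Bool) → count L + count R ≡ suc n →
         {a c : Fin (suc n)} → L a ≡ true → R c ≡ true →
         ∃₂ λ i j → L i ≡ true × R j ≡ true × (i ≡ j ⊎ i ≡ cyclicPred j)
bridge {n} L R count-L+R {a} {c} La Rc with count (λ k → L k ∧ R k) in shared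
... | suc _ with (k , Lk∧Rk) ← 0<count⇒∃ (λ k → L k ∧ R k) (subst (0 <_) (sym shared) (s≤s z≤n)) =
  k , k , proj₁ (∧-true Lk∧Rk) , proj₂ (∧-true Lk∧Rk) , inj₁ refl
... | zero with any? (λ j → (L (cyclicPred j) ≟ᵇ true) ×-dec (L j ≟ᵇ false))
...   | yes (j , Lpj , Lj) = cyclicPred j , j , Lpj , subst (λ b → (b ∨ R j) ≡ true) Lj (cover j) , inj₂ refl
  where
  cover : ∀ k → (L k ∨ R k) ≡ true
  cover = count≡n⇒true (λ k → L k ∨ R k) (begin
    count (λ k → L k ∨ R k)                            ≡⟨ +-identityʳ _ ⟨
    count (λ k → L k ∨ R k) + 0                        ≡⟨ cong (count (λ k → L k ∨ R k) +_) shared ⟨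
    count (λ k → L k ∨ R k) + count (λ k → L k ∧ R k)  ≡⟨ count-∨+count-∧ L R ⟩
    count L + count R                                  ≡⟨ count-L+R ⟩
    suc n                                              ∎)
    where open ≡-Reasoning
...   | no no-step = ⊥-elim (not-both (cyclic-induction (λ j → L j ≡ true) La closed c))
  where
  closed : ∀ j → L (cyclicPred j) ≡ true → L j ≡ true
  closed j Lpj with L j in Lj
  ... | true  = refl
  ... | false = ⊥-elim (no-step (j , Lpj , Lj))
  not-both : L c ≡ true → ⊥
  not-both Lc with () ← trans (sym (count≡0⇒false (λ k → L k ∧ R k) shared c)) (cong₂ _∧_ Lc Rc)

module Ladder (n : ℕ) where

  m : ℕ
  m = suc (suc n)

  -- (s , i) is node s · m + i
  vertex : Fin 2 → Fin m → Fin (2 * m)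
  vertex = combine

  rung : Fin m → Fin m → Bool
  rung i j = does ((i ≟ j) ⊎-dec (i ≟ cyclicPred j))

  ladder : Fin 2 × Fin m → Fin 2 × Fin m → Bool
  ladder (zero     , i) (zero     , j) = not (does (i ≟ j))
  ladder (zero     , i) (suc zero , j) = rung i j
  ladder (suc zero , i) (zero     , j) = rung j i
  ladder (suc zero , i) (suc zero , j) = not (does (i ≟ j))

  ladder-sym : ∀ p q → ladder p q ≡ ladder q p
  ladder-sym (zero     , i) (zero     , j) = cong not (does-≟-sym i j)
  ladder-sym (zero     , i) (suc zero , j) = refl
  ladder-sym (suc zero , i) (zero     , j) = refl
  ladder-sym (suc zero , i) (suc zero , j) = cong not (does-≟-sym i j)

  ladder-same-side : ∀ s i j → ladder (s , i) (s , j) ≡ not (does (i ≟ j))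
  ladder-same-side zero       i j = refl
  ladder-same-side (suc zero) i j = refl

  ladder-irrefl : ∀ p → ladder p p ≡ false
  ladder-irrefl (s , i) = trans (ladder-same-side s i i) (cong not (dec-true (i ≟ i) refl))

  G : Network (2 * m)
  G = record
    { adj    = λ x y → ladder (remQuot m x) (remQuot m y)
    ; sym    = λ x y → ladder-sym (remQuot m x) (remQuot m y)
    ; irrefl = λ x → ladder-irrefl (remQuot m x)
    }

  vertex-surjective : ∀ x → ∃₂ λ s i → vertex s i ≡ x
  vertex-surjective x = proj₁ (remQuot {2} m x) , proj₂ (remQuot {2} m x) , combine-remQuot {2} m x

  adj-vertex : ∀ s i t j → adj G (vertex s i) (vertex t j) ≡ ladder (s , i) (t , j)
  adj-vertex s i t j = cong₂ ladder (remQuot-combine s i) (remQuot-combine t j)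

  count-rung-in : ∀ j → count (λ i → rung i j) ≡ 2
  count-rung-in j = count-≟-∨ (cyclicPred-irrefl j ∘ sym)

  degree-vertex : ∀ s i → degree G (vertex s i) ≡
                   count (λ j → ladder (s , i) (zero , j)) + (count (λ j → ladder (s , i) (suc zero , j)) + 0)
  degree-vertex s i = trans (count-combine {2} {m} (adj G (vertex s i)))
                             (sumFin-cong λ t → count-cong (adj-vertex s i t))

  degree-left : ∀ i → degree G (vertex zero i) ≡ suc n + count (rung i)
  degree-left i = trans (degree-vertex zero i) (cong₂ _+_ (count-≢ i) (+-identityʳ _))

  degree-right : ∀ j → degree G (vertex (suc zero) j) ≡ suc m
  degree-right j = trans (degree-vertex (suc zero) j)
                         (cong₂ _+_ (count-rung-in j) (trans (+-identityʳ _) (count-≢ j)))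

  degree-sum : sumFin (degree G) ≡ (m * m + m) + (m * m + m)
  degree-sum = begin
    sumFin (degree G)
      ≡⟨ sumFin-combine {2} {m} (degree G) ⟩
    sumFin (λ i → degree G (vertex zero i)) + (sumFin (λ j → degree G (vertex (suc zero) j)) + 0)
      ≡⟨ cong₂ (λ x y → x + (y + 0)) left-sum (trans (sumFin-cong degree-right) (sumFin-const m (suc m))) ⟩
    (m * suc n + m * 2) + (m * suc m + 0)
      ≡⟨ arithmetic n ⟩
    (m * m + m) + (m * m + m)
      ∎
    where
    open ≡-Reasoning
    left-sum : sumFin (λ i → degree G (vertex zero i)) ≡ m * suc n + m * 2
    left-sum = begin
      sumFin (λ i → degree G (vertex zero i))       ≡⟨ sumFin-cong degree-left ⟩
      sumFin (λ i → suc n + count (rung i))          ≡⟨ sumFin-+ (λ _ → suc n) (count ∘ rung) ⟩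
      sumFin {m} (λ _ → suc n) + sumFin (count ∘ rung) ≡⟨ cong₂ _+_ (sumFin-const m (suc n)) (count-swap rung) ⟩
      m * suc n + sumFin (λ j → count (λ i → rung i j)) ≡⟨ cong (m * suc n +_) (sumFin-cong count-rung-in) ⟩
      m * suc n + sumFin {m} (λ _ → 2)               ≡⟨ cong (m * suc n +_) (sumFin-const m 2) ⟩
      m * suc n + m * 2                              ∎
    arithmetic : ∀ n → let m = 2 + n in (m * (1 + n) + m * 2) + (m * (1 + m) + 0) ≡ (m * m + m) + (m * m + m)
    arithmetic = solve-∀

  links-G : links G ≡ m * m + m
  links-G = begin
    links G                  ≡⟨ n≡⌊n+n/2⌋ (links G) ⟩
    ⌊ links G + links G /2⌋  ≡⟨ cong ⌊_/2⌋ (trans (handshake G) degree-sum) ⟩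
    ⌊ (m * m + m) + (m * m + m) /2⌋ ≡⟨ n≡⌊n+n/2⌋ (m * m + m) ⟨
    m * m + m                ∎
    where open ≡-Reasoning

  robust : Robust m G
  robust S ∣S∣≡m u v u∉S v∉S
    with (s , i , refl) ← vertex-surjective u | (t , j , refl) ← vertex-surjective v =
    connect s i t j u∉S v∉S
    where
    Step : Fin (2 * m) → Fin (2 * m) → Set
    Step = StepOutside G S

    survivor : Fin 2 → Fin m → Bool
    survivor s i = not (lookup S (vertex s i))

    survivor-true : ∀ s i → vertex s i ∉ S → survivor s i ≡ true
    survivor-true s i h = cong not (∉⇒lookup≡false S (vertex s i) h)

    survivor⇒∉ : ∀ s i → survivor s i ≡ true → vertex s i ∉ S
    survivor⇒∉ s i h = lookup≡false⇒∉ S (vertex s i) (not-injective h)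

    count-outside : count (not ∘ lookup S) ≡ m
    count-outside = +-cancelʳ-≡ m _ m (begin
      count (not ∘ lookup S) + m                 ≡⟨ cong (count (not ∘ lookup S) +_) (trans (sym ∣S∣≡m) (∣p∣≡count S)) ⟩
      count (not ∘ lookup S) + count (lookup S)  ≡⟨ count-not+count (lookup S) ⟩
      m + (m + 0)                                ≡⟨ cong (m +_) (+-identityʳ m) ⟩
      m + m                                      ∎)
      where open ≡-Reasoning

    count-survivors : count (survivor zero) + count (survivor (suc zero)) ≡ m
    count-survivors = begin
      count (survivor zero) + count (survivor (suc zero))        ≡⟨ cong (count (survivor zero) +_) (+-identityʳ _) ⟨
      count (survivor zero) + (count (survivor (suc zero)) + 0)  ≡⟨ count-combine {2} {m} (not ∘ lookup S) ⟨
      count (not ∘ lookup S)                                     ≡⟨ count-outside ⟩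
      m                                                          ∎
      where open ≡-Reasoning

    within : ∀ s i j → vertex s i ∉ S → vertex s j ∉ S → Star Step (vertex s i) (vertex s j)
    within s i j i∉S j∉S with i ≟ j
    ... | yes refl = ε
    ... | no  i≢j  = (i∉S , j∉S , trans (adj-vertex s i s j)
                                   (trans (ladder-same-side s i j) (cong not (dec-false (i ≟ j) i≢j)))) ◅ ε

    across : ∀ i j → vertex zero i ∉ S → vertex (suc zero) j ∉ S →
             Star Step (vertex zero i) (vertex (suc zero) j)
    across i j i∉S j∉S
      with (i′ , j′ , Li′ , Rj′ , i′~j′) ← bridge (survivor zero) (survivor (suc zero)) count-survivors
                                                  (survivor-true zero i i∉S) (survivor-true (suc zero) j j∉S) =
      within zero i i′ i∉S (survivor⇒∉ zero i′ Li′) ◅◅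
      (survivor⇒∉ zero i′ Li′ , survivor⇒∉ (suc zero) j′ Rj′ ,
       trans (adj-vertex zero i′ (suc zero) j′)
             (dec-true ((i′ ≟ j′) ⊎-dec (i′ ≟ cyclicPred j′)) i′~j′)) ◅
      within (suc zero) j′ j (survivor⇒∉ (suc zero) j′ Rj′) j∉S

    connect : ∀ s i t j → vertex s i ∉ S → vertex t j ∉ S → Star Step (vertex s i) (vertex t j)
    connect zero       i zero       j = within zero i j
    connect (suc zero) i (suc zero) j = within (suc zero) i j
    connect zero       i (suc zero) j = across i j
    connect (suc zero) i zero       j i∉S j∉S = reverse (StepOutside-sym G S) (across j i j∉S i∉S)

lemma2 : ∀ (m : ℕ) → 3 ≤ m →
    ((G : Network (2 * m)) → links G < m * m + m →
      ∃[ S ] (∣ S ∣ ≡ m × ¬ ConnectedAfterRemoving G S))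
    × (∃[ G ] (links {2 * m} G ≡ m * m + m × Robust m G))
lemma2 m@(suc (suc n)) 3≤m = sparse⇒cut m (<⇒≤ 3≤m) , Ladder.G n , Ladder.links-G n , Ladder.robust n
lemma2 (suc zero) (s≤s ())
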